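{- Let $\gamma$ be an infinite limit ordinal and $n$ a positive integer. Let $u=(\alpha,\beta)\in\gamma\times\gamma$ and $v$ be two distinct vertices of $\mathcal G_{\gamma+n}$. Then $\eta(u,v)\geq\min(\alpha,\beta)$ (computed in $\mathcal G_{\gamma+n}$).
   Context: $\mathcal G_\gamma$ is the graph with vertex set $\gamma\times\gamma$ in which two distinct vertices $(\alpha_0,\beta_0),(\alpha_1,\beta_1)$ are adjacent iff $\alpha_0=\alpha_1=0$, or $\beta_0=\beta_1=0$, or ($\alpha_0=\beta_0$ and $\alpha_1=\beta_1$), or ($\alpha_0<\alpha_1$ and $\beta_0>\beta_1$), or ($\alpha_0>\alpha_1$ and $\beta_0<\beta_1$). $\mathcal G_{\gamma+n}$ is the graph with vertex set $(\gamma\times\gamma)\cup(\{ -(n+1),\dots,-1\}\times\{0\})$ whose edges are all edges of $\mathcal G_\gamma$ together with the pairs $\{(-i,0),(-i+1,0)\}$ for $i=1,\dots,n+1$. $N[v]$ is the closed neighbourhood of $v$. Relations $\leq_\alpha$ on the vertex set for ordinals $\alpha$: $u\leq_0 v$ iff $u=v$; $u\leq_\alpha v$ if for every $x\in N[u]$ there is $y\in N[v]$ with $x\leq_\delta y$ for some $\delta<\alpha$. $\eta(u,v)$ is the minimum ordinal $\alpha$ with $u\leq_\alpha v$. -}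

module Defs where

open import Level using (0ℓ)
open import Data.Nat using (ℕ; suc)
open import Data.Fin using (Fin; zero; suc; toℕ)
open import Data.Product using (Σ; ∃; _×_; _,_)
open import Data.Sum using (_⊎_; inj₁; inj₂)
open import Data.Empty using (⊥)
open import Relation.Nullary using (¬_)
open import Relation.Binary using (Rel; IsStrictTotalOrder; tri<; tri≈; tri>)
open import Relation.Binary.PropositionalEquality using (_≡_)
open import Induction.WellFounded using (WellFounded; Acc; acc)

-- An infinite limit ordinal γ, presented (up to isomorphism) as a
-- well-founded strict total order (with propositional equality, hence
-- extensional) that has a least element 0 and no largest element
-- (non-zero and not a successor).
record InfLimitOrdinal : Set₁ where
  field
    Carrier   : Set
    _<_       : Rel Carrier 0ℓ
    isSTO     : IsStrictTotalOrder _≡_ _<_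
    wf        : WellFounded _<_
    𝟘         : Carrier
    𝟘-least   : ∀ x → ¬ (x < 𝟘)
    noMax     : ∀ x → ∃ λ y → x < y

module _ (γ : InfLimitOrdinal) where
  open InfLimitOrdinal γ
  open IsStrictTotalOrder isSTO using (compare)

  minO : Carrier → Carrier → Carrier
  minO a b with compare a b
  ... | tri< _ _ _ = a
  ... | tri≈ _ _ _ = a
  ... | tri> _ _ _ = b

  -- Vertices of G_{γ+n}: γ×γ together with the tail vertices
  -- (-(i+1), 0) for i : Fin (suc n), i.e. -1, …, -(n+1).
  Vtx : ℕ → Set
  Vtx n = (Carrier × Carrier) ⊎ Fin (suc n)

  AdjCore : Carrier × Carrier → Carrier × Carrier → Set
  AdjCore (a₀ , b₀) (a₁ , b₁) =
    ¬ ((a₀ , b₀) ≡ (a₁ , b₁)) ×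
    ( (a₀ ≡ 𝟘 × a₁ ≡ 𝟘)
    ⊎ (b₀ ≡ 𝟘 × b₁ ≡ 𝟘)
    ⊎ (a₀ ≡ b₀ × a₁ ≡ b₁)
    ⊎ (a₀ < a₁ × b₁ < b₀)
    ⊎ (a₁ < a₀ × b₀ < b₁) )

  Adj : (n : ℕ) → Vtx n → Vtx n → Set
  Adj n (inj₁ p) (inj₁ q) = AdjCore p q
  Adj n (inj₁ (a , b)) (inj₂ zero) = (a ≡ 𝟘) × (b ≡ 𝟘)
  Adj n (inj₁ _) (inj₂ (suc _)) = ⊥
  Adj n (inj₂ zero) (inj₁ (a , b)) = (a ≡ 𝟘) × (b ≡ 𝟘)
  Adj n (inj₂ (suc _)) (inj₁ _) = ⊥
  Adj n (inj₂ i) (inj₂ j) = (toℕ j ≡ suc (toℕ i)) ⊎ (toℕ i ≡ suc (toℕ j))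

  N[_]∋_ : {n : ℕ} → Vtx n → Vtx n → Set
  N[_]∋_ {n} u x = (x ≡ u) ⊎ Adj n u x

  -- The relations ≤_a, for a an ordinal below γ, by well-founded recursion:
  -- u ≤_0 v iff u = v;  for a > 0, u ≤_a v iff every x ∈ N[u] has some
  -- y ∈ N[v] and some δ < a with x ≤_δ y.
  LeqAcc : {n : ℕ} (a : Carrier) → Acc _<_ a → Vtx n → Vtx n → Set
  LeqAcc a (acc rs) u v =
    (((δ : Carrier) → ¬ (δ < a)) × (u ≡ v))
    ⊎ (((δ : Carrier) → δ < a → ⊥) → ⊥) ×
      (∀ x → N[ u ]∋ x → Σ _ λ y → N[ v ]∋ y ×
         Σ Carrier λ δ → Σ (δ < a) λ δ<a → LeqAcc δ (rs δ<a) x y)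

  Leq : (n : ℕ) → Carrier → Vtx n → Vtx n → Set
  Leq n a u v = LeqAcc {n} a (wf a) u v

module Submission where

-- Suppose u = (α,β) ≤_δ v with 0 < δ < α, β. Each neighbour x of u with both
-- coordinates ≥ δ is matched by some y ∈ N[v] with x ≤_{δ'} y, δ' < δ, so x = y by induction and
-- x ∈ N[v]; in particular u ∈ N[v]. This is refuted by a private neighbour: whenever w ≠ u is
-- adjacent to u, some neighbour x of u with coordinates ≥ δ is comparable with w in the product
-- order and not on the diagonal together with w, hence neither equal nor adjacent to w. It is built
-- from δ, the coordinates of w and a point above them, which exists since γ is a limit.

open import Defs
open import Data.Nat using (ℕ)
open import Data.Product using (Σ; _×_; _,_)
open import Data.Sum using (_⊎_; inj₁; inj₂)
open import Data.Fin using (zero; suc)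
open import Relation.Nullary using (¬_; contradiction)
open import Relation.Binary using (IsStrictTotalOrder; tri<; tri≈; tri>)
open import Relation.Binary.PropositionalEquality using (_≡_; _≢_; refl)
open import Induction.WellFounded using (Acc; acc)
import Relation.Binary.Construct.StrictToNonStrict as StrictToNonStrict

module _ (γ : InfLimitOrdinal) where
  open InfLimitOrdinal γ
  open IsStrictTotalOrder isSTO using (compare; irrefl; <-respʳ-≈) renaming (trans to <-trans)
  open StrictToNonStrict _≡_ _<_ using (_≤_; <⇒≤; reflexive; total)

  Pair : Set
  Pair = Carrier × Carrier

  <-irrefl : ∀ {x} → ¬ x < x
  <-irrefl = irrefl refl

  >⇒≢ : ∀ {x y} → y < x → x ≢ y
  >⇒≢ x<x refl = <-irrefl x<x

  <-≤-trans : ∀ {x y z} → x < y → y ≤ z → x < z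
  <-≤-trans = StrictToNonStrict.<-≤-trans _≡_ _<_ <-trans <-respʳ-≈

  𝟘<-if-has-predecessor : ∀ {d} → ¬ (∀ δ → ¬ δ < d) → 𝟘 < d
  𝟘<-if-has-predecessor {d} has-pred with compare 𝟘 d
  ... | tri< 𝟘<d _ _ = 𝟘<d
  ... | tri≈ _ refl _ = contradiction 𝟘-least has-pred
  ... | tri> _ _ d<𝟘 = contradiction d<𝟘 (𝟘-least d)

  <-minO⇒<-both : ∀ {δ α β} → δ < minO γ α β → δ < α × δ < β
  <-minO⇒<-both {δ} {α} {β} δ<min with compare α β
  ... | tri< α<β _ _ = δ<min , <-trans δ<min α<β
  ... | tri≈ _ refl _ = δ<min , δ<min
  ... | tri> _ _ β<α = <-trans δ<min β<α , δ<min

  -- For d > 0 this keeps x off the two axes, where adjacency in G_γ is special.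
  High : Carrier → Pair → Set
  High d (p , q) = d ≤ p × d ≤ q

  _≼_ : Pair → Pair → Set
  (a , b) ≼ (p , q) = a ≤ p × b ≤ q

  module _ {n : ℕ} where

    _∈N[_] : Vtx γ n → Vtx γ n → Set
    x ∈N[ v ] = N[_]∋_ γ v x

    -- Comparable vertices off the axes can only be adjacent through the diagonal clause.
    ∉N[]-if-comparable : ∀ {a b p q} → 𝟘 < p → 𝟘 < q → (p , q) ≢ (a , b) → ¬ (a ≡ b × p ≡ q) →
                         (a , b) ≼ (p , q) ⊎ (p , q) ≼ (a , b) → ¬ inj₁ (p , q) ∈N[ inj₁ (a , b) ]
    ∉N[]-if-comparable _ _ x≢w _ _ (inj₁ refl) = x≢w refl
    ∉N[]-if-comparable 𝟘<p _ _ _ _ (inj₂ (_ , inj₁ (_ , p≡𝟘))) = >⇒≢ 𝟘<p p≡𝟘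
    ∉N[]-if-comparable _ 𝟘<q _ _ _ (inj₂ (_ , inj₂ (inj₁ (_ , q≡𝟘)))) = >⇒≢ 𝟘<q q≡𝟘
    ∉N[]-if-comparable _ _ _ not-diagonal _ (inj₂ (_ , inj₂ (inj₂ (inj₁ diagonal)))) = not-diagonal diagonal
    ∉N[]-if-comparable _ _ _ _ (inj₁ (_ , b≤q)) (inj₂ (_ , inj₂ (inj₂ (inj₂ (inj₁ (_ , q<b)))))) =
      <-irrefl (<-≤-trans q<b b≤q)
    ∉N[]-if-comparable _ _ _ _ (inj₂ (p≤a , _)) (inj₂ (_ , inj₂ (inj₂ (inj₂ (inj₁ (a<p , _)))))) =
      <-irrefl (<-≤-trans a<p p≤a)
    ∉N[]-if-comparable _ _ _ _ (inj₁ (a≤p , _)) (inj₂ (_ , inj₂ (inj₂ (inj₂ (inj₂ (p<a , _)))))) =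
      <-irrefl (<-≤-trans p<a a≤p)
    ∉N[]-if-comparable _ _ _ _ (inj₂ (_ , q≤b)) (inj₂ (_ , inj₂ (inj₂ (inj₂ (inj₂ (_ , b<q)))))) =
      <-irrefl (<-≤-trans b<q q≤b)

    PrivateNeighbour : Carrier → Pair → Pair → Set
    PrivateNeighbour d u w = Σ Pair λ x → High d x × AdjCore γ u x × ¬ inj₁ x ∈N[ inj₁ w ]

    comparable-private-neighbour : ∀ {d u a b} p q → 𝟘 < d → High d (p , q) → AdjCore γ u (p , q) →
                                   (p , q) ≢ (a , b) → ¬ (a ≡ b × p ≡ q) →
                                   (a , b) ≼ (p , q) ⊎ (p , q) ≼ (a , b) → PrivateNeighbour d u (a , b)
    comparable-private-neighbour p q 𝟘<d (d≤p , d≤q) u~x x≢w not-diagonal comparable =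
      (p , q) , (d≤p , d≤q) , u~x ,
      ∉N[]-if-comparable (<-≤-trans 𝟘<d d≤p) (<-≤-trans 𝟘<d d≤q) x≢w not-diagonal comparable

    private-neighbour-diagonal : ∀ {d α a} → 𝟘 < d → d < α → a ≢ α → PrivateNeighbour d (α , α) (a , a)
    private-neighbour-diagonal {d} {α} {a} 𝟘<d d<α a≢α with compare a α
    ... | tri≈ _ a≡α _ = contradiction a≡α a≢α
    ... | tri> _ _ α<a = comparable-private-neighbour d a 𝟘<d (reflexive refl , <⇒≤ d<a)
          ((λ { refl → <-irrefl d<α }) , inj₂ (inj₂ (inj₂ (inj₂ (d<α , α<a)))))
          (λ { refl → <-irrefl d<a }) (λ { (_ , refl) → <-irrefl d<a }) (inj₂ (<⇒≤ d<a , reflexive refl))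
      where d<a = <-trans d<α α<a
    ... | tri< a<α _ _ with noMax α
    ...   | p , α<p with total compare d a
    ...     | inj₁ d≤a = comparable-private-neighbour p a 𝟘<d (<⇒≤ (<-trans d<α α<p) , d≤a)
              ((λ { refl → <-irrefl α<p }) , inj₂ (inj₂ (inj₂ (inj₁ (α<p , a<α)))))
              (λ { refl → <-irrefl a<p }) (λ { (_ , refl) → <-irrefl a<p }) (inj₁ (<⇒≤ a<p , reflexive refl))
      where a<p = <-trans a<α α<p
    ...     | inj₂ a≤d = comparable-private-neighbour p d 𝟘<d (<⇒≤ d<p , reflexive refl)
              ((λ { refl → <-irrefl α<p }) , inj₂ (inj₂ (inj₂ (inj₁ (α<p , d<α)))))
              (λ { refl → <-irrefl a<p }) (λ { (_ , refl) → <-irrefl d<p }) (inj₁ (<⇒≤ a<p , a≤d))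
      where a<p = <-trans a<α α<p
            d<p = <-trans d<α α<p

    private-neighbour-β<b : ∀ {d α β a b} → 𝟘 < d → d < α → d < β → β < b → PrivateNeighbour d (α , β) (a , b)
    private-neighbour-β<b {d} {α} {β} {a} {b} 𝟘<d d<α d<β β<b with compare d a
    ... | tri< d<a _ _ = comparable-private-neighbour d b 𝟘<d (reflexive refl , <⇒≤ d<b)
          ((λ { refl → <-irrefl d<α }) , inj₂ (inj₂ (inj₂ (inj₂ (d<α , β<b)))))
          (λ { refl → <-irrefl d<a }) (λ { (_ , refl) → <-irrefl d<b }) (inj₂ (<⇒≤ d<a , reflexive refl))
      where d<b = <-trans d<β β<b
    ... | tri> _ _ a<d = comparable-private-neighbour d b 𝟘<d (reflexive refl , <⇒≤ d<b)
          ((λ { refl → <-irrefl d<α }) , inj₂ (inj₂ (inj₂ (inj₂ (d<α , β<b)))))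
          (λ { refl → <-irrefl a<d }) (λ { (_ , refl) → <-irrefl d<b }) (inj₁ (<⇒≤ a<d , reflexive refl))
      where d<b = <-trans d<β β<b
    ... | tri≈ _ refl _ with noMax b
    ...   | p , b<p = comparable-private-neighbour d p 𝟘<d (reflexive refl , <⇒≤ d<p)
            ((λ { refl → <-irrefl d<α }) , inj₂ (inj₂ (inj₂ (inj₂ (d<α , <-trans β<b b<p)))))
            (λ { refl → <-irrefl b<p }) (λ { (_ , refl) → <-irrefl d<p }) (inj₁ (reflexive refl , <⇒≤ b<p))
      where d<p = <-trans d<β (<-trans β<b b<p)

    private-neighbour-α<a : ∀ {d α β a b} → 𝟘 < d → d < α → d < β → α < a → PrivateNeighbour d (α , β) (a , b)
    private-neighbour-α<a {d} {α} {β} {a} {b} 𝟘<d d<α d<β α<a with compare d b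
    ... | tri< d<b _ _ = comparable-private-neighbour a d 𝟘<d (<⇒≤ d<a , reflexive refl)
          ((λ { refl → <-irrefl α<a }) , inj₂ (inj₂ (inj₂ (inj₁ (α<a , d<β)))))
          (λ { refl → <-irrefl d<b }) (λ { (_ , refl) → <-irrefl d<a }) (inj₂ (reflexive refl , <⇒≤ d<b))
      where d<a = <-trans d<α α<a
    ... | tri> _ _ b<d = comparable-private-neighbour a d 𝟘<d (<⇒≤ d<a , reflexive refl)
          ((λ { refl → <-irrefl α<a }) , inj₂ (inj₂ (inj₂ (inj₁ (α<a , d<β)))))
          (λ { refl → <-irrefl b<d }) (λ { (_ , refl) → <-irrefl d<a }) (inj₁ (reflexive refl , <⇒≤ b<d))
      where d<a = <-trans d<α α<a
    ... | tri≈ _ refl _ with noMax a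
    ...   | p , a<p = comparable-private-neighbour p d 𝟘<d (<⇒≤ d<p , reflexive refl)
            ((λ { refl → <-irrefl (<-trans α<a a<p) }) , inj₂ (inj₂ (inj₂ (inj₁ (<-trans α<a a<p , d<β)))))
            (λ { refl → <-irrefl a<p }) (λ { (_ , refl) → <-irrefl d<p }) (inj₁ (<⇒≤ a<p , reflexive refl))
      where d<p = <-trans d<α (<-trans α<a a<p)

    private-neighbour : ∀ {d α β a b} → 𝟘 < d → d < α → d < β → AdjCore γ (a , b) (α , β) →
                        PrivateNeighbour d (α , β) (a , b)
    private-neighbour {d} _ d<α _ (_ , inj₁ (_ , refl)) = contradiction d<α (𝟘-least d)
    private-neighbour {d} _ _ d<β (_ , inj₂ (inj₁ (_ , refl))) = contradiction d<β (𝟘-least d)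
    private-neighbour 𝟘<d d<α _ (w≢u , inj₂ (inj₂ (inj₁ (refl , refl)))) =
      private-neighbour-diagonal 𝟘<d d<α λ { refl → w≢u refl }
    private-neighbour 𝟘<d d<α d<β (_ , inj₂ (inj₂ (inj₂ (inj₁ (_ , β<b))))) = private-neighbour-β<b 𝟘<d d<α d<β β<b
    private-neighbour 𝟘<d d<α d<β (_ , inj₂ (inj₂ (inj₂ (inj₂ (α<a , _))))) = private-neighbour-α<a 𝟘<d d<α d<β α<a

    -- Double-negated: membership in N[v] is not decidable, and the induction can only refute non-membership.
    HighNeighboursShared : Carrier → Vtx γ n → Vtx γ n → Set
    HighNeighboursShared d u v = ∀ x → High d x → inj₁ x ∈N[ u ] → ¬ ¬ inj₁ x ∈N[ v ]

    high-neighbours-shared⇒∉N[] : ∀ {d α β} → 𝟘 < d → d < α → d < β → (v : Vtx γ n) → inj₁ (α , β) ≢ v →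
                                  HighNeighboursShared d (inj₁ (α , β)) v → ¬ inj₁ (α , β) ∈N[ v ]
    high-neighbours-shared⇒∉N[] _ _ _ _ u≢v _ (inj₁ u≡v) = u≢v u≡v
    high-neighbours-shared⇒∉N[] {d} _ d<α _ (inj₂ zero) _ _ (inj₂ (refl , _)) = 𝟘-least d d<α
    high-neighbours-shared⇒∉N[] _ _ _ (inj₂ (suc _)) _ _ (inj₂ ())
    high-neighbours-shared⇒∉N[] 𝟘<d d<α d<β (inj₁ w) _ shared (inj₂ w~u) with private-neighbour 𝟘<d d<α d<β w~u
    ... | x , high , u~x , x∉N[w] = shared x high (inj₂ u~x) x∉N[w]

    ¬LeqAcc-below-coordinates : ∀ {d α β} (rec : Acc _<_ d) → d < α → d < β → (v : Vtx γ n) → inj₁ (α , β) ≢ v →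
                   ¬ LeqAcc γ d rec (inj₁ (α , β)) v
    ¬LeqAcc-below-coordinates (acc _) _ _ _ u≢v (inj₁ (_ , u≡v)) = u≢v u≡v
    ¬LeqAcc-below-coordinates {d} {α} {β} (acc rs) d<α d<β v u≢v (inj₂ (has-pred , simulate)) =
      shared (α , β) (<⇒≤ d<α , <⇒≤ d<β) (inj₁ refl)
        (high-neighbours-shared⇒∉N[] (𝟘<-if-has-predecessor has-pred) d<α d<β v u≢v shared)
      where
      shared : HighNeighboursShared d (inj₁ (α , β)) v
      shared x (d≤p , d≤q) x∈N[u] x∉N[v] with simulate (inj₁ x) x∈N[u]
      ... | y , y∈N[v] , δ , δ<d , x≤y =
        ¬LeqAcc-below-coordinates (rs δ<d) (<-≤-trans δ<d d≤p) (<-≤-trans δ<d d≤q) y (λ { refl → x∉N[v] y∈N[v] }) x≤y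

open import Data.Nat using (_≤_)

lemma13 : (γ : InfLimitOrdinal) → let open InfLimitOrdinal γ in
    (n : ℕ) → 1 ≤ n →
    (α β : Carrier) (v : Vtx γ n) →
    ¬ (inj₁ (α , β) ≡ v) →
    (δ : Carrier) → δ < minO γ α β → ¬ Leq γ n δ (inj₁ (α , β)) v
lemma13 γ n _ α β v u≢v δ δ<min with <-minO⇒<-both γ δ<min
... | δ<α , δ<β = ¬LeqAcc-below-coordinates γ (InfLimitOrdinal.wf γ δ) δ<α δ<β v u≢v
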